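{- Let $G$ be a graph on $n$ vertices with vertex cover number $k\ge 3$. Then $2k-1\le R(B^3G,B^3G)\le n-k+2R(K_k,K_k)$.
   Context: The vertex cover number of $G$ is the minimum number of vertices such that every edge of $G$ is incident to at least one of them. $R(K_k,K_k)$ is the classical two-color graph Ramsey number. A 3-uniform hypergraph consists of a vertex set and a set of 3-element subsets (hyperedges); $\mathcal{K}_N^3$ is the complete 3-uniform hypergraph on $N$ vertices. A 3-uniform hypergraph $\mathcal{H}$ contains a Berge-$G$ if there are an injection $\varphi:V(G)\to V(\mathcal{H})$ and an injection $f$ from $E(G)$ to the hyperedges of $\mathcal{H}$ with $\{\varphi(x),\varphi(y)\}\subseteq f(xy)$ for every edge $xy$. $R(B^3G,B^3G)$ is the smallest $N$ such that for every coloring of the hyperedges of $\mathcal{K}_N^3$ with two colors, the hyperedges of one color contain a Berge-$G$. -}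

module Defs where

open import Data.Nat using (ℕ; _<_; _≤_)
open import Data.Bool using (Bool; true; false)
open import Data.Fin using (Fin)
import Data.Fin as F
open import Data.Fin.Subset using (Subset; _∈_; ∣_∣)
open import Data.Product using (Σ; _×_)
open import Data.Sum using (_⊎_)
open import Relation.Nullary using (¬_)
open import Relation.Binary.PropositionalEquality using (_≡_)

record Graph (n : ℕ) : Set where
  field
    adj    : Fin n → Fin n → Bool
    sym    : ∀ x y → adj x y ≡ adj y x
    irrefl : ∀ x → adj x x ≡ false
open Graph public

IsVertexCover : ∀ {n} → Graph n → Subset n → Set
IsVertexCover G S = ∀ x y → adj G x y ≡ true → (x ∈ S) ⊎ (y ∈ S)

VertexCoverNumber : ∀ {n} → Graph n → ℕ → Set
VertexCoverNumber {n} G k =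
  Σ (Subset n) (λ S → IsVertexCover G S × ∣ S ∣ ≡ k)
  × (∀ S → IsVertexCover G S → k ≤ ∣ S ∣)

IsLeast : (ℕ → Set) → ℕ → Set
IsLeast P N = P N × (∀ m → m < N → ¬ P m)

-- Every 2-colouring of the edges of K_N contains a monochromatic K_k.
-- A colouring gives the edge {i,j} (i < j) the colour c i j.
KArrow : ℕ → ℕ → Set
KArrow k N = ∀ (c : Fin N → Fin N → Bool) →
  Σ Bool λ col → Σ (Fin k → Fin N) λ φ →
    (∀ i j → i F.< j → φ i F.< φ j) ×
    (∀ i j → i F.< j → c (φ i) (φ j) ≡ col)

GraphRamseyK : ℕ → ℕ → Set
GraphRamseyK k r = IsLeast (KArrow k) r

record Triple (N : ℕ) : Set where
  constructor triple
  field
    a b c : Fin N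
    a<b   : a F.< b
    b<c   : b F.< c
open Triple public

_∈ₜ_ : ∀ {N} → Fin N → Triple N → Set
v ∈ₜ t = (v ≡ a t) ⊎ ((v ≡ b t) ⊎ (v ≡ c t))

SameTriple : ∀ {N} → Triple N → Triple N → Set
SameTriple s t = (a s ≡ a t) × ((b s ≡ b t) × (c s ≡ c t))

record Edge {n : ℕ} (G : Graph n) : Set where
  field
    u v  : Fin n
    u<v  : u F.< v
    isE  : adj G u v ≡ true
open Edge public

SameEdge : ∀ {n} {G : Graph n} → Edge G → Edge G → Set
SameEdge e e' = (u e ≡ u e') × (v e ≡ v e')

-- A 2-colouring of the hyperedges of K_N^3: hyperedge {a<b<c} gets colour col a b c.
Colouring3 : ℕ → Set
Colouring3 N = Fin N → Fin N → Fin N → Bool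

colourOf : ∀ {N} → Colouring3 N → Triple N → Bool
colourOf col t = col (a t) (b t) (c t)

ContainsBerge : ∀ {n} → Graph n → ∀ {N} → Colouring3 N → Bool → Set
ContainsBerge {n} G {N} col cl =
  Σ (Fin n → Fin N) λ φ →
    (∀ x y → φ x ≡ φ y → x ≡ y) ×
    Σ (Edge G → Triple N) λ f →
      (∀ e e' → SameTriple (f e) (f e') → SameEdge e e') ×
      (∀ e → colourOf col (f e) ≡ cl) ×
      (∀ e → (φ (u e) ∈ₜ f e) × (φ (v e) ∈ₜ f e))

BergeArrow : ∀ {n} → Graph n → ℕ → Set
BergeArrow G N = ∀ (col : Colouring3 N) → Σ Bool λ cl → ContainsBerge G col cl

BergeRamsey : ∀ {n} → Graph n → ℕ → Set
BergeRamsey G R = IsLeast (BergeArrow G) R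

-- Lower bound: colour a triple of [N] by whether its middle vertex lies among the first k − 1
-- positions. A hyperedge of the first colour has at most one vertex outside those positions, so
-- the vertices of a Berge-G in that colour placed there form a vertex cover of size at most k − 1;
-- likewise for the second colour and the last N − k + 1 ≤ k − 1 positions when N < 2k − 1.
--
-- Upper bound: take 2R(K_k,K_k) − 1 low vertices and n − k + 1 high ones, the first high one
-- being a hub. For a low vertex p, the hyperedges through p colour the pairs of high vertices,
-- and in one of the two colours the hub reaches every high vertex in at most two steps. Keep
-- R(K_k,K_k) low vertices sharing this colour c and colour a pair of them by whether some high
-- vertex completes it to a hyperedge of colour c. A Ramsey clique of k of them carries a Berge
-- copy of K_k joined to n − k outer vertices: in colour c if all its pairs can be completed
-- (spokes go through the hub or a two-step path), in the other colour otherwise (spokes use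
-- the pair {i, π i} for a rotation π). That split graph contains G, whose vertex cover has size k.
-- Finally, the least N exists because the Berge arrow property is decidable by exhaustive search.

module Submission where

open import Defs
open import Level using (0ℓ)
open import Data.Nat using (ℕ; zero; suc; _≤_; _<_; _+_; _*_; _∸_; _⊓_; _⊔_; _<ᵇ_; z≤n; s≤s; s≤s⁻¹)
import Data.Nat.Properties as ℕ
open import Data.Nat.Solver using (module +-*-Solver)
open import Data.Bool using (Bool; true; false; not)
import Data.Bool.Properties as Bool
open import Data.Fin using (Fin; zero; suc; toℕ; fromℕ<; punchOut; _↑ˡ_; _↑ʳ_)
import Data.Fin as Fin
import Data.Fin.Properties as Fin
open import Data.Fin.Subset using (Subset; inside; outside; ∁; ∣_∣)
  renaming (_∈_ to _∈ₛ_; _∉_ to _∉ₛ_)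
open import Data.Fin.Subset.Properties using (_∈?_; x∉p⇒x∈∁p; x∈∁p⇒x∉p; ∣p∣≤n; ∣∁p∣≡n∸∣p∣)
open import Data.Vec using (Vec; []; _∷_; lookup; tabulate; removeAt; here; there)
open import Data.Vec.Properties
  using (lookup∘tabulate; lookup⇒[]=; []=⇒lookup; tabulate-cong; removeAt-punchOut)
open import Data.Product using (Σ; ∃; _×_; _,_; proj₁; proj₂; map₂; swap)
open import Data.Sum using (_⊎_; inj₁; inj₂)
import Data.Sum as Sum
open import Data.Empty using (⊥; ⊥-elim)
open import Function using (_∘_; id)
open import Function.Bundles using (Equivalence)
open import Function.Definitions using (Injective)
open import Relation.Nullary using (¬_; Dec; yes; no; does; contradiction)
open import Relation.Nullary.Decidable using (map′; _×-dec_; _⊎-dec_; _→-dec_; ¬?; decidable-stable)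
open import Relation.Unary using (Pred; Decidable)
open import Relation.Binary using (tri<; tri≈; tri>; _Preserves_⟶_)
open import Relation.Binary.PropositionalEquality as ≡
  using (_≡_; _≢_; refl; trans; cong; subst; subst₂)

leastUpTo : {P : ℕ → Set} → (∀ m → Dec (P m)) →
  ∀ U → (∀ m → m ≤ U → ¬ P m) ⊎ Σ ℕ λ R → IsLeast P R × R ≤ U
leastUpTo P? zero with P? zero
... | yes p = inj₂ (zero , (p , λ _ ()) , z≤n)
... | no ¬p = inj₁ λ { zero z≤n → ¬p }
leastUpTo P? (suc U) with leastUpTo P? U
... | inj₂ (R , isLeast , R≤U) = inj₂ (R , isLeast , ℕ.m≤n⇒m≤1+n R≤U)
... | inj₁ none with P? (suc U)
...   | yes p = inj₂ (suc U , (p , λ m m<1+U → none m (s≤s⁻¹ m<1+U)) , ℕ.≤-refl)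
...   | no ¬p = inj₁ λ m m≤1+U → Sum.[ (λ m<1+U → none m (s≤s⁻¹ m<1+U)) , (λ { refl → ¬p }) ]
                                    (ℕ.m≤n⇒m<n∨m≡n m≤1+U)

least-between : {P : ℕ → Set} → (∀ m → Dec (P m)) → ∀ {L U} → (∀ m → m < L → ¬ P m) → P U →
  Σ ℕ λ R → IsLeast P R × L ≤ R × R ≤ U
least-between P? {U = U} none-below pU with leastUpTo P? U
... | inj₁ none = contradiction pU (none U ℕ.≤-refl)
... | inj₂ (R , isLeast@(pR , _) , R≤U) = R , isLeast , ℕ.≮⇒≥ (λ R<L → none-below R R<L pR) , R≤U

does≡true⇒ : ∀ {A : Set} (a? : Dec A) → does a? ≡ true → A
does≡true⇒ (yes a) _ = a
does≡true⇒ (no _) ()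

does≡false⇒¬ : ∀ {A : Set} (a? : Dec A) → does a? ≡ false → ¬ A
does≡false⇒¬ (yes _) ()
does≡false⇒¬ (no ¬a) _ = ¬a

Exhaustible : Set → Set₁
Exhaustible A = ∀ {P : Pred A 0ℓ} → Decidable P → Dec (∃ P)

Bool-exhaustible : Exhaustible Bool
Bool-exhaustible P? = map′ Sum.[ (true ,_) , (false ,_) ]
  (λ { (true , p) → inj₁ p ; (false , p) → inj₂ p }) (P? true ⊎-dec P? false)

×-exhaustible : ∀ {A B} → Exhaustible A → Exhaustible B → Exhaustible (A × B)
×-exhaustible A? B? P? = map′ (λ (a , b , p) → (a , b) , p) (λ ((a , b) , p) → a , b , p)
  (A? λ a → B? λ b → P? (a , b))

Vec-exhaustible : ∀ {A} → Exhaustible A → ∀ n → Exhaustible (Vec A n)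
Vec-exhaustible A? zero P? = map′ ([] ,_) (λ { ([] , p) → p }) (P? [])
Vec-exhaustible A? (suc n) P? = map′ (λ (a , v , p) → a ∷ v , p) (λ { (a ∷ v , p) → a , v , p })
  (A? λ a → Vec-exhaustible A? n λ v → P? (a ∷ v))

∀-dec : ∀ {A} → Exhaustible A → {P : Pred A 0ℓ} → Decidable P → Dec (∀ a → P a)
∀-dec A? P? = map′ (λ ∄¬P a → decidable-stable (P? a) (λ ¬p → ∄¬P (a , ¬p)))
                   (λ ∀P (a , ¬p) → ¬p (∀P a)) (¬? (A? (¬? ∘ P?)))

Triple′ : ℕ → Set
Triple′ N = Fin N × Fin N × Fin N

module _ {N : ℕ} where

  Triple′-exhaustible : Exhaustible (Triple′ N)
  Triple′-exhaustible = ×-exhaustible Fin.any? (×-exhaustible Fin.any? Fin.any?)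

  a′ b′ c′ : Triple′ N → Fin N
  a′ = proj₁
  b′ = proj₁ ∘ proj₂
  c′ = proj₂ ∘ proj₂

  toTriple′ : Triple N → Triple′ N
  toTriple′ t = a t , b t , c t

  SameTriple′ : Triple′ N → Triple′ N → Set
  SameTriple′ s t = a′ s ≡ a′ t × b′ s ≡ b′ t × c′ s ≡ c′ t

  -- The fields are spelled out so that, for t = toTriple′ u, this is definitionally
  -- the data of u together with the membership conditions of ContainsBerge.
  Carries : Colouring3 N → Bool → Fin N → Fin N → Triple′ N → Set
  Carries col cl p q t = a′ t Fin.< b′ t × b′ t Fin.< c′ t × col (a′ t) (b′ t) (c′ t) ≡ cl
    × (p ≡ a′ t ⊎ p ≡ b′ t ⊎ p ≡ c′ t) × (q ≡ a′ t ⊎ q ≡ b′ t ⊎ q ≡ c′ t)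

  SameTriple′? : ∀ s t → Dec (SameTriple′ s t)
  SameTriple′? s t = a′ s Fin.≟ a′ t ×-dec b′ s Fin.≟ b′ t ×-dec c′ s Fin.≟ c′ t

  ∈′? : ∀ p t → Dec (p ≡ a′ t ⊎ p ≡ b′ t ⊎ p ≡ c′ t)
  ∈′? p t = p Fin.≟ a′ t ⊎-dec p Fin.≟ b′ t ⊎-dec p Fin.≟ c′ t

  Carries? : ∀ col cl p q t → Dec (Carries col cl p q t)
  Carries? col cl p q t = a′ t Fin.<? b′ t ×-dec b′ t Fin.<? c′ t
    ×-dec col (a′ t) (b′ t) (c′ t) Bool.≟ cl ×-dec ∈′? p t ×-dec ∈′? q t

module BergeDecidable {n : ℕ} (G : Graph n) where

  IsEdge : Fin n → Fin n → Set
  IsEdge x y = x Fin.< y × adj G x y ≡ true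

  IsEdge? : ∀ x y → Dec (IsEdge x y)
  IsEdge? x y = x Fin.<? y ×-dec adj G x y Bool.≟ true

  toEdge : ∀ {x y} → IsEdge x y → Edge G
  toEdge {x} {y} (x<y , xy∈G) = record { u = x ; v = y ; u<v = x<y ; isE = xy∈G }

  -- τ x y is the hyperedge used for the edge x < y; its values at non-edges are irrelevant.
  IsBergeTable : ∀ {N} → Colouring3 N → Bool → (Fin n → Fin N) → (Fin n → Fin n → Triple′ N) → Set
  IsBergeTable col cl φ τ =
      (∀ x y → φ x ≡ φ y → x ≡ y)
    × (∀ x y → IsEdge x y → Carries col cl (φ x) (φ y) (τ x y))
    × (∀ x y x′ y′ → IsEdge x y → IsEdge x′ y′ → SameTriple′ (τ x y) (τ x′ y′) → x ≡ x′ × y ≡ y′)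

  IsBergeTable? : ∀ {N} col cl (φ : Fin n → Fin N) τ → Dec (IsBergeTable col cl φ τ)
  IsBergeTable? col cl φ τ =
    Fin.all? (λ x → Fin.all? λ y → φ x Fin.≟ φ y →-dec x Fin.≟ y)
    ×-dec Fin.all? (λ x → Fin.all? λ y → IsEdge? x y →-dec Carries? col cl (φ x) (φ y) (τ x y))
    ×-dec Fin.all? (λ x → Fin.all? λ y → Fin.all? λ x′ → Fin.all? λ y′ →
            IsEdge? x y →-dec IsEdge? x′ y′ →-dec SameTriple′? (τ x y) (τ x′ y′)
              →-dec (x Fin.≟ x′ ×-dec y Fin.≟ y′))

  IsBergeTable-resp : ∀ {N col cl} {φ ψ : Fin n → Fin N} {τ σ : Fin n → Fin n → Triple′ N} →
    (∀ x → φ x ≡ ψ x) → (∀ x y → τ x y ≡ σ x y) →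
    IsBergeTable col cl φ τ → IsBergeTable col cl ψ σ
  IsBergeTable-resp {col = col} {cl} {φ} {ψ} {τ} {σ} φ≗ψ τ≗σ (φ-inj , carries , τ-inj) =
    (λ x y ψx≡ψy → φ-inj x y (trans (φ≗ψ x) (trans ψx≡ψy (≡.sym (φ≗ψ y))))) ,
    (λ x y xy → subst₂ (λ p q → Carries col cl p q (σ x y)) (φ≗ψ x) (φ≗ψ y)
                  (subst (Carries col cl (φ x) (φ y)) (τ≗σ x y) (carries x y xy))) ,
    λ x y x′ y′ xy x′y′ same → τ-inj x y x′ y′ xy x′y′
      (subst₂ SameTriple′ (≡.sym (τ≗σ x y)) (≡.sym (τ≗σ x′ y′)) same)

  module _ {N} {col : Colouring3 N} {cl : Bool} where

    fromTable : ∀ {φ τ} → IsBergeTable col cl φ τ → ContainsBerge G col cl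
    fromTable {φ} {τ} (φ-inj , carries , τ-inj) =
      φ , φ-inj , f , (λ e e′ → τ-inj _ _ _ _ (edge e) (edge e′)) ,
      (λ e → proj₁ (proj₂ (proj₂ (carries _ _ (edge e))))) ,
      (λ e → proj₂ (proj₂ (proj₂ (carries _ _ (edge e)))))
      where
      edge : (e : Edge G) → IsEdge (u e) (v e)
      edge e = u<v e , isE e
      f : Edge G → Triple N
      f e = let t = τ (u e) (v e) ; (a<b , b<c , _) = carries _ _ (edge e) in
            triple (a′ t) (b′ t) (c′ t) a<b b<c

    toTable : ContainsBerge G col cl → Σ (Fin n → Fin N) λ φ → Σ (Fin n → Fin n → Triple′ N) λ τ →
      IsBergeTable col cl φ τ
    toTable (φ , φ-inj , f , f-inj , f-colour , f-∋) = φ , τ , φ-inj , carries , τ-inj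
      where
      τ : Fin n → Fin n → Triple′ N
      τ x y with IsEdge? x y
      ... | yes xy = toTriple′ (f (toEdge xy))
      ... | no _ = φ x , φ x , φ x
      τ-edge : ∀ x y → IsEdge x y → Σ (IsEdge x y) λ xy → τ x y ≡ toTriple′ (f (toEdge xy))
      τ-edge x y xy with IsEdge? x y
      ... | yes xy′ = xy′ , refl
      ... | no ¬xy = contradiction xy ¬xy
      carries : ∀ x y → IsEdge x y → Carries col cl (φ x) (φ y) (τ x y)
      carries x y xy with τ-edge x y xy
      ... | xy′ , eq rewrite eq =
        let e = toEdge xy′ in a<b (f e) , b<c (f e) , f-colour e , f-∋ e
      τ-inj : ∀ x y x′ y′ → IsEdge x y → IsEdge x′ y′ → SameTriple′ (τ x y) (τ x′ y′) →
              x ≡ x′ × y ≡ y′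
      τ-inj x y x′ y′ xy x′y′ same with τ-edge x y xy | τ-edge x′ y′ x′y′
      ... | e , eq | e′ , eq′ rewrite eq | eq′ = f-inj (toEdge e) (toEdge e′) same

    ContainsBerge? : Dec (ContainsBerge G col cl)
    ContainsBerge? = map′ (λ (φv , τv , table) → fromTable table)
      (λ berge → let (φ , τ , table) = toTable berge in
        tabulate φ , tabulate (tabulate ∘ τ) ,
        IsBergeTable-resp {col = col} {cl} (≡.sym ∘ lookup∘tabulate φ)
          (λ x y → ≡.sym (trans (cong (λ row → lookup row y) (lookup∘tabulate (tabulate ∘ τ) x))
                              (lookup∘tabulate (τ x) y)))
          table)
      (Vec-exhaustible Fin.any? n λ φv →
         Vec-exhaustible (Vec-exhaustible Triple′-exhaustible n) n λ τv →
           IsBergeTable? col cl (lookup φv) (λ x y → lookup (lookup τv x) y))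

  ContainsBerge-resp : ∀ {N} {col col′ : Colouring3 N} {cl} → (∀ x y z → col x y z ≡ col′ x y z) →
    ContainsBerge G col cl → ContainsBerge G col′ cl
  ContainsBerge-resp col≗col′ (φ , φ-inj , f , f-inj , f-colour , f-∋) =
    φ , φ-inj , f , f-inj , (λ e → trans (≡.sym (col≗col′ _ _ _)) (f-colour e)) , f-∋

  BergeArrow? : ∀ N → Dec (BergeArrow G N)
  BergeArrow? N = map′
    (λ arrow col → map₂ (ContainsBerge-resp (lookup∘tabulate³ col))
                         (arrow (tabulate λ x → tabulate λ y → tabulate (col x y))))
    (λ arrow table → arrow (λ x y z → lookup (lookup (lookup table x) y) z))
    (∀-dec (Vec-exhaustible (Vec-exhaustible (Vec-exhaustible Bool-exhaustible N) N) N) λ table →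
       Bool-exhaustible λ cl → ContainsBerge? {col = λ x y z → lookup (lookup (lookup table x) y) z})
    where
    lookup∘tabulate³ : (col : Colouring3 N) → ∀ x y z →
      lookup (lookup (lookup (tabulate λ x → tabulate λ y → tabulate (col x y)) x) y) z ≡ col x y z
    lookup∘tabulate³ col x y z
      rewrite lookup∘tabulate (λ x → tabulate λ y → tabulate (col x y)) x
            | lookup∘tabulate (λ y → tabulate (col x y)) y = lookup∘tabulate (col x y) z

∣x∷inside∷p∣ : ∀ {n} x (p : Subset n) → ∣ x ∷ inside ∷ p ∣ ≡ suc ∣ x ∷ p ∣
∣x∷inside∷p∣ inside  p = refl
∣x∷inside∷p∣ outside p = refl

∣x∷p∣≤∣x∷q∣ : ∀ {n m} x {p : Subset n} {q : Subset m} → ∣ p ∣ ≤ ∣ q ∣ → ∣ x ∷ p ∣ ≤ ∣ x ∷ q ∣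
∣x∷p∣≤∣x∷q∣ inside  = s≤s
∣x∷p∣≤∣x∷q∣ outside = id

∣p[i]∷removeAt∣≡∣p∣ : ∀ {n} (p : Subset (suc n)) i → ∣ lookup p i ∷ removeAt p i ∣ ≡ ∣ p ∣
∣p[i]∷removeAt∣≡∣p∣ (x ∷ p) zero = refl
∣p[i]∷removeAt∣≡∣p∣ (x ∷ []) (suc ())
∣p[i]∷removeAt∣≡∣p∣ (outside ∷ p@(_ ∷ _)) (suc i) = ∣p[i]∷removeAt∣≡∣p∣ p i
∣p[i]∷removeAt∣≡∣p∣ (inside ∷ p@(_ ∷ _)) (suc i) =
  trans (∣x∷inside∷p∣ (lookup p i) (removeAt p i)) (cong suc (∣p[i]∷removeAt∣≡∣p∣ p i))

preimage : ∀ {n m} → (Fin n → Fin m) → Subset m → Subset n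
preimage φ p = tabulate (lookup p ∘ φ)

∣preimage∣≤∣p∣ : ∀ {n m} {φ : Fin n → Fin m} → Injective _≡_ _≡_ φ → ∀ p → ∣ preimage φ p ∣ ≤ ∣ p ∣
∣preimage∣≤∣p∣ {zero} _ p = z≤n
∣preimage∣≤∣p∣ {suc n} {zero} {φ} _ p = ⊥-elim (Fin.¬Fin0 (φ zero))
∣preimage∣≤∣p∣ {suc n} {suc m} {φ} φ-inj p = begin
  ∣ lookup p y ∷ preimage (φ ∘ suc) p ∣
    ≡⟨ cong (λ s → ∣ lookup p y ∷ s ∣) (tabulate-cong λ x → ≡.sym (removeAt-punchOut p (y≢ x))) ⟩
  ∣ lookup p y ∷ preimage φ′ (removeAt p y) ∣
    ≤⟨ ∣x∷p∣≤∣x∷q∣ (lookup p y) {preimage φ′ (removeAt p y)} {removeAt p y}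
                  (∣preimage∣≤∣p∣ φ′-inj (removeAt p y)) ⟩
  ∣ lookup p y ∷ removeAt p y ∣
    ≡⟨ ∣p[i]∷removeAt∣≡∣p∣ p y ⟩
  ∣ p ∣ ∎
  where
  open ℕ.≤-Reasoning
  y = φ zero
  y≢ : ∀ x → y ≢ φ (suc x)
  y≢ x eq with φ-inj eq
  ... | ()
  φ′ : Fin n → Fin m
  φ′ x = punchOut (y≢ x)
  φ′-inj : Injective _≡_ _≡_ φ′
  φ′-inj eq = Fin.suc-injective (φ-inj (Fin.punchOut-injective (y≢ _) (y≢ _) eq))

∈-tabulate⁺ : ∀ {n} {f : Fin n → Bool} {x} → f x ≡ true → x ∈ₛ tabulate f
∈-tabulate⁺ {f = f} {x} fx≡true = lookup⇒[]= x (tabulate f) (trans (lookup∘tabulate f x) fx≡true)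

∈-tabulate⁻ : ∀ {n} {f : Fin n → Bool} {x} → x ∈ₛ tabulate f → f x ≡ true
∈-tabulate⁻ {f = f} {x} x∈ = trans (≡.sym (lookup∘tabulate f x)) ([]=⇒lookup x∈)

rank : ∀ {n} → Subset n → Fin n → ℕ
rank (_ ∷ p) zero = 0
rank (outside ∷ p) (suc x) = rank p x
rank (inside ∷ p) (suc x) = suc (rank p x)

rank<∣p∣ : ∀ {n} {p : Subset n} {x} → x ∈ₛ p → rank p x < ∣ p ∣
rank<∣p∣ here = s≤s z≤n
rank<∣p∣ (there {y = outside} x∈p) = rank<∣p∣ x∈p
rank<∣p∣ (there {y = inside} x∈p) = s≤s (rank<∣p∣ x∈p)

rank-mono : ∀ {n} {p : Subset n} {x y} → x Fin.< y → x ∈ₛ p → rank p x < rank p y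
rank-mono {y = suc y} _ here = s≤s z≤n
rank-mono {y = suc y} x<y (there {y = outside} x∈p) = rank-mono (s≤s⁻¹ x<y) x∈p
rank-mono {y = suc y} x<y (there {y = inside} x∈p) = s≤s (rank-mono (s≤s⁻¹ x<y) x∈p)

index : ∀ {n} {p : Subset n} {x} → x ∈ₛ p → Fin ∣ p ∣
index x∈p = fromℕ< (rank<∣p∣ x∈p)

index-mono : ∀ {n} {p : Subset n} {x y} (x∈p : x ∈ₛ p) (y∈p : y ∈ₛ p) →
  x Fin.< y → index x∈p Fin.< index y∈p
index-mono x∈p y∈p x<y =
  subst₂ _<_ (≡.sym (Fin.toℕ-fromℕ< (rank<∣p∣ x∈p))) (≡.sym (Fin.toℕ-fromℕ< (rank<∣p∣ y∈p)))
    (rank-mono x<y x∈p)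

index-injective : ∀ {n} {p : Subset n} {x y} (x∈p : x ∈ₛ p) (y∈p : y ∈ₛ p) →
  index x∈p ≡ index y∈p → x ≡ y
index-injective {x = x} {y} x∈p y∈p eq with Fin.<-cmp x y
... | tri< x<y _ _ = contradiction eq (Fin.<⇒≢ (index-mono x∈p y∈p x<y))
... | tri≈ _ x≡y _ = x≡y
... | tri> _ _ y<x = contradiction (≡.sym eq) (Fin.<⇒≢ (index-mono y∈p x∈p y<x))

edgeCover⇒vertexCover : ∀ {n} {G : Graph n} {S} → (∀ (e : Edge G) → u e ∈ₛ S ⊎ v e ∈ₛ S) →
  IsVertexCover G S
edgeCover⇒vertexCover {G = G} covers x y xy∈G with Fin.<-cmp x y
... | tri< x<y _ _ = covers (record { u = x ; v = y ; u<v = x<y ; isE = xy∈G })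
... | tri≈ _ refl _ = contradiction (trans (≡.sym xy∈G) (irrefl G x)) λ ()
... | tri> _ _ y<x =
  Sum.swap (covers (record { u = y ; v = x ; u<v = y<x ; isE = trans (Graph.sym G y x) xy∈G }))

TwoTransversal : ∀ {N} → Colouring3 N → Bool → Subset N → Set
TwoTransversal col cl S =
  ∀ t → colourOf col t ≡ cl → ∀ p q → p ≢ q → p ∈ₜ t → q ∈ₜ t → p ∈ₛ S ⊎ q ∈ₛ S

vertexCoverNumber≤∣twoTransversal∣ : ∀ {n} {G : Graph n} {k N} {col : Colouring3 N} {cl S} →
  VertexCoverNumber G k → ContainsBerge G col cl → TwoTransversal col cl S → k ≤ ∣ S ∣
vertexCoverNumber≤∣twoTransversal∣ {S = S} (_ , minimal) (φ , φ-inj , f , _ , f-colour , f-∋) meets =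
  ℕ.≤-trans (minimal (preimage φ S) (edgeCover⇒vertexCover covers)) (∣preimage∣≤∣p∣ (φ-inj _ _) S)
  where
  covers : ∀ e → u e ∈ₛ preimage φ S ⊎ v e ∈ₛ preimage φ S
  covers e = Sum.map ∈-preimage ∈-preimage
    (meets (f e) (f-colour e) _ _ (Fin.<⇒≢ (u<v e) ∘ φ-inj _ _) (proj₁ (f-∋ e)) (proj₂ (f-∋ e)))
    where
    ∈-preimage : ∀ {x} → φ x ∈ₛ S → x ∈ₛ preimage φ S
    ∈-preimage = ∈-tabulate⁺ ∘ []=⇒lookup

middle-between : ∀ {N} (t : Triple N) {p q} → p ≢ q → p ∈ₜ t → q ∈ₜ t →
  toℕ p ⊓ toℕ q ≤ toℕ (b t) × toℕ (b t) ≤ toℕ p ⊔ toℕ q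
middle-between t p≢q (inj₁ refl) (inj₁ refl) = contradiction refl p≢q
middle-between t _ (inj₁ refl) (inj₂ (inj₁ refl)) = ℕ.m⊓n≤n _ _ , ℕ.m≤n⊔m _ _
middle-between t _ (inj₁ refl) (inj₂ (inj₂ refl)) =
  ℕ.≤-trans (ℕ.m⊓n≤m _ _) (ℕ.<⇒≤ (a<b t)) , ℕ.≤-trans (ℕ.<⇒≤ (b<c t)) (ℕ.m≤n⊔m _ _)
middle-between t _ (inj₂ (inj₁ refl)) _ = ℕ.m⊓n≤m _ _ , ℕ.m≤m⊔n _ _
middle-between t _ (inj₂ (inj₂ refl)) (inj₁ refl) =
  ℕ.≤-trans (ℕ.m⊓n≤n _ _) (ℕ.<⇒≤ (a<b t)) , ℕ.≤-trans (ℕ.<⇒≤ (b<c t)) (ℕ.m≤m⊔n _ _)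
middle-between t _ (inj₂ (inj₂ refl)) (inj₂ (inj₁ refl)) = ℕ.m⊓n≤n _ _ , ℕ.m≤n⊔m _ _
middle-between t p≢q (inj₂ (inj₂ refl)) (inj₂ (inj₂ refl)) = contradiction refl p≢q

below : ∀ {m} → ℕ → Subset m
below K = tabulate λ y → toℕ y <ᵇ K

∈below⁺ : ∀ {m K} {y : Fin m} → toℕ y < K → y ∈ₛ below K
∈below⁺ y<K = ∈-tabulate⁺ (Equivalence.to Bool.T-≡ (ℕ.<⇒<ᵇ y<K))

∈below⁻ : ∀ {m K} {y : Fin m} → y ∈ₛ below K → toℕ y < K
∈below⁻ {K = K} {y} y∈ = ℕ.<ᵇ⇒< (toℕ y) K (Equivalence.from Bool.T-≡ (∈-tabulate⁻ y∈))

∣below∣≤ : ∀ m K → ∣ below {m} K ∣ ≤ K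
∣below∣≤ zero K = z≤n
∣below∣≤ (suc m) zero = ℕ.≤-reflexive (∣tabulate-false∣ m)
  where
  ∣tabulate-false∣ : ∀ m → ∣ tabulate {n = m} (λ _ → false) ∣ ≡ 0
  ∣tabulate-false∣ zero = refl
  ∣tabulate-false∣ (suc m) = ∣tabulate-false∣ m
∣below∣≤ (suc m) (suc K) = s≤s (∣below∣≤ m K)

∣∁below∣≤ : ∀ m K → ∣ ∁ (below {m} K) ∣ ≤ m ∸ K
∣∁below∣≤ zero K = z≤n
∣∁below∣≤ (suc m) zero = ∣p∣≤n (∁ (below zero))
∣∁below∣≤ (suc m) (suc K) = ∣∁below∣≤ m K

thresholdColouring : ∀ {m} → ℕ → Colouring3 m
thresholdColouring K _ y _ = toℕ y <ᵇ K

below-twoTransversal : ∀ {m} K → TwoTransversal (thresholdColouring {m} K) true (below K)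
below-twoTransversal K t colour p q p≢q p∈t q∈t with p ∈? below K | q ∈? below K
... | yes p∈ | _ = inj₁ p∈
... | no _ | yes q∈ = inj₂ q∈
... | no p∉ | no q∉ = contradiction (∈below⁻ (∈-tabulate⁺ colour))
  (ℕ.≤⇒≯ (ℕ.≤-trans (ℕ.⊓-glb (≥K p∉) (≥K q∉)) (proj₁ (middle-between t p≢q p∈t q∈t))))
  where
  ≥K : ∀ {y} → y ∉ₛ below K → K ≤ toℕ y
  ≥K y∉ = ℕ.≮⇒≥ (y∉ ∘ ∈below⁺)

∁below-twoTransversal : ∀ {m} K → TwoTransversal (thresholdColouring {m} K) false (∁ (below K))
∁below-twoTransversal K t colour p q p≢q p∈t q∈t with p ∈? below K | q ∈? below K
... | no p∉ | _ = inj₁ (x∉p⇒x∈∁p p∉)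
... | yes _ | no q∉ = inj₂ (x∉p⇒x∈∁p q∉)
... | yes p∈ | yes q∈ = contradiction (trans (≡.sym (∈-tabulate⁻ middle∈)) colour) λ ()
  where
  middle∈ : b t ∈ₛ below K
  middle∈ = ∈below⁺ {K = K}
    (ℕ.≤-<-trans (proj₂ (middle-between t p≢q p∈t q∈t)) (ℕ.⊔-lub (∈below⁻ p∈) (∈below⁻ q∈)))

lowerBound : ∀ {n} {G : Graph n} {K m} → VertexCoverNumber G (suc K) → m < 2 * suc K ∸ 1 →
  ¬ BergeArrow G m
lowerBound {K = K} {m} vc m<2k∸1 arrow with arrow (thresholdColouring K)
... | true , berge = ℕ.1+n≰n (begin
  suc K             ≤⟨ vertexCoverNumber≤∣twoTransversal∣ vc berge (below-twoTransversal K) ⟩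
  ∣ below {m} K ∣   ≤⟨ ∣below∣≤ m K ⟩
  K                 ∎)
  where open ℕ.≤-Reasoning
... | false , berge = ℕ.1+n≰n (begin
  suc K             ≤⟨ vertexCoverNumber≤∣twoTransversal∣ vc berge (∁below-twoTransversal K) ⟩
  ∣ ∁ (below {m} K) ∣ ≤⟨ ∣∁below∣≤ m K ⟩
  m ∸ K             ≤⟨ ℕ.m≤n+o⇒m∸n≤o m K (s≤s⁻¹ (subst (m <_) 2k∸1≡1+K+K m<2k∸1)) ⟩
  K                 ∎)
  where
  open ℕ.≤-Reasoning
  2k∸1≡1+K+K : 2 * suc K ∸ 1 ≡ suc (K + K)
  2k∸1≡1+K+K = trans (ℕ.+-suc K (K + 0)) (cong (λ n → suc (K + n)) (ℕ.+-identityʳ K))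

strictlyMonotone⇒injective : ∀ {a b} {f : Fin a → Fin b} →
  f Preserves Fin._<_ ⟶ Fin._<_ → Injective _≡_ _≡_ f
strictlyMonotone⇒injective f-mono {x} {y} eq with Fin.<-cmp x y
... | tri< x<y _ _ = contradiction eq (Fin.<⇒≢ (f-mono x<y))
... | tri≈ _ x≡y _ = x≡y
... | tri> _ _ y<x = contradiction (≡.sym eq) (Fin.<⇒≢ (f-mono y<x))

record OrderedPair {m} (x y : Fin m) : Set where
  field
    lo hi    : Fin m
    lo<hi    : lo Fin.< hi
    ordering : (lo ≡ x × hi ≡ y) ⊎ (lo ≡ y × hi ≡ x)
open OrderedPair

orderPair : ∀ {m} {x y : Fin m} → x ≢ y → OrderedPair x y
orderPair {x = x} {y} x≢y with x Fin.<? y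
... | yes x<y = record { lo = x ; hi = y ; lo<hi = x<y ; ordering = inj₁ (refl , refl) }
... | no x≮y = record { lo = y ; hi = x ; lo<hi = Fin.≤∧≢⇒< (ℕ.≮⇒≥ x≮y) (x≢y ∘ ≡.sym)
                      ; ordering = inj₂ (refl , refl) }

module _ {m} {x y : Fin m} (s : OrderedPair x y) where

  lo-or-hi₁ : x ≡ lo s ⊎ x ≡ hi s
  lo-or-hi₁ with ordering s
  ... | inj₁ (refl , _) = inj₁ refl
  ... | inj₂ (_ , refl) = inj₂ refl

  lo-or-hi₂ : y ≡ lo s ⊎ y ≡ hi s
  lo-or-hi₂ with ordering s
  ... | inj₁ (_ , refl) = inj₂ refl
  ... | inj₂ (refl , _) = inj₁ refl

samePair : ∀ {m} {x y x′ y′ : Fin m} (s : OrderedPair x y) (s′ : OrderedPair x′ y′) →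
  lo s ≡ lo s′ → hi s ≡ hi s′ → (x ≡ x′ × y ≡ y′) ⊎ (x ≡ y′ × y ≡ x′)
samePair s s′ lo≡ hi≡ with ordering s | ordering s′ | lo≡ | hi≡
... | inj₁ (refl , refl) | inj₁ (refl , refl) | refl | refl = inj₁ (refl , refl)
... | inj₁ (refl , refl) | inj₂ (refl , refl) | refl | refl = inj₂ (refl , refl)
... | inj₂ (refl , refl) | inj₁ (refl , refl) | refl | refl = inj₂ (refl , refl)
... | inj₂ (refl , refl) | inj₂ (refl , refl) | refl | refl = inj₁ (refl , refl)

record SplitBerge (k M : ℕ) {N} (col : Colouring3 N) (cl : Bool) : Set where
  field
    core            : Fin k → Fin N
    outer           : Fin M → Fin N
    core-injective  : Injective _≡_ _≡_ core
    outer-injective : Injective _≡_ _≡_ outer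
    core≢outer      : ∀ i x → core i ≢ outer x
    edge            : ∀ i j → i Fin.< j → Triple N
    spoke           : Fin k → Fin M → Triple N
    edge-colour     : ∀ i j i<j → colourOf col (edge i j i<j) ≡ cl
    spoke-colour    : ∀ i x → colourOf col (spoke i x) ≡ cl
    edge-∋          : ∀ i j i<j → core i ∈ₜ edge i j i<j × core j ∈ₜ edge i j i<j
    spoke-∋         : ∀ i x → core i ∈ₜ spoke i x × outer x ∈ₜ spoke i x
    edge-injective  : ∀ i j i<j i′ j′ i′<j′ → SameTriple (edge i j i<j) (edge i′ j′ i′<j′) →
                      i ≡ i′ × j ≡ j′
    spoke-injective : ∀ i x i′ x′ → SameTriple (spoke i x) (spoke i′ x′) → i ≡ i′ × x ≡ x′
    edge≢spoke      : ∀ i j i<j i′ x → ¬ SameTriple (edge i j i<j) (spoke i′ x)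

SameTriple-sym : ∀ {N} {s t : Triple N} → SameTriple s t → SameTriple t s
SameTriple-sym (a≡ , b≡ , c≡) = ≡.sym a≡ , ≡.sym b≡ , ≡.sym c≡

module _ {n} {G : Graph n} {S : Subset n} (cover : IsVertexCover G S)
         {N} {col : Colouring3 N} {cl} (B : SplitBerge ∣ S ∣ ∣ ∁ S ∣ col cl) where
  open SplitBerge B

  data Side (x : Fin n) : Set where
    inS  : x ∈ₛ S → Side x
    outS : x ∈ₛ ∁ S → Side x

  side : ∀ x → Side x
  side x with x ∈? S
  ... | yes x∈S = inS x∈S
  ... | no x∉S = outS (x∉p⇒x∈∁p x∉S)

  place : ∀ {x} → Side x → Fin N
  place (inS x∈S) = core (index x∈S)
  place (outS x∈∁S) = outer (index x∈∁S)

  place-injective : ∀ {x y} (sx : Side x) (sy : Side y) → place sx ≡ place sy → x ≡ y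
  place-injective (inS x∈) (inS y∈) eq = index-injective x∈ y∈ (core-injective eq)
  place-injective (inS x∈) (outS y∈) eq = contradiction eq (core≢outer _ _)
  place-injective (outS x∈) (inS y∈) eq = contradiction (≡.sym eq) (core≢outer _ _)
  place-injective (outS x∈) (outS y∈) eq = index-injective x∈ y∈ (outer-injective eq)

  noOuterEdge : ∀ (e : Edge G) → u e ∈ₛ ∁ S → v e ∈ₛ ∁ S → ⊥
  noOuterEdge e u∈∁S v∈∁S = Sum.[ x∈∁p⇒x∉p u∈∁S , x∈∁p⇒x∉p v∈∁S ] (cover (u e) (v e) (isE e))

  hyperedge : (e : Edge G) → Side (u e) → Side (v e) → Triple N
  hyperedge e (inS u∈) (inS v∈) = edge (index u∈) (index v∈) (index-mono u∈ v∈ (u<v e))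
  hyperedge e (inS u∈) (outS v∈) = spoke (index u∈) (index v∈)
  hyperedge e (outS u∈) (inS v∈) = spoke (index v∈) (index u∈)
  hyperedge e (outS u∈) (outS v∈) = ⊥-elim (noOuterEdge e u∈ v∈)

  hyperedge-colour : ∀ e su sv → colourOf col (hyperedge e su sv) ≡ cl
  hyperedge-colour e (inS _) (inS _) = edge-colour _ _ _
  hyperedge-colour e (inS _) (outS _) = spoke-colour _ _
  hyperedge-colour e (outS _) (inS _) = spoke-colour _ _
  hyperedge-colour e (outS u∈) (outS v∈) = ⊥-elim (noOuterEdge e u∈ v∈)

  hyperedge-∋ : ∀ e su sv → place su ∈ₜ hyperedge e su sv × place sv ∈ₜ hyperedge e su sv
  hyperedge-∋ e (inS _) (inS _) = edge-∋ _ _ _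
  hyperedge-∋ e (inS _) (outS _) = spoke-∋ _ _
  hyperedge-∋ e (outS _) (inS _) = swap (spoke-∋ _ _)
  hyperedge-∋ e (outS u∈) (outS v∈) = ⊥-elim (noOuterEdge e u∈ v∈)

  edges-not-reversed : ∀ (e e′ : Edge G) → v e ≡ u e′ → v e′ ≡ u e → ⊥
  edges-not-reversed e e′ refl refl = Fin.<-asym (u<v e) (u<v e′)

  hyperedge-injective : ∀ e su sv e′ su′ sv′ →
    SameTriple (hyperedge e su sv) (hyperedge e′ su′ sv′) → SameEdge e e′
  hyperedge-injective e (outS u∈) (outS v∈) _ _ _ _ = ⊥-elim (noOuterEdge e u∈ v∈)
  hyperedge-injective _ _ _ e′ (outS u∈) (outS v∈) _ = ⊥-elim (noOuterEdge e′ u∈ v∈)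
  hyperedge-injective e (inS u∈) (inS v∈) e′ (inS u∈′) (inS v∈′) same
    with i≡ , j≡ ← edge-injective _ _ _ _ _ _ same =
      index-injective u∈ u∈′ i≡ , index-injective v∈ v∈′ j≡
  hyperedge-injective e (inS u∈) (outS v∈) e′ (inS u∈′) (outS v∈′) same
    with i≡ , x≡ ← spoke-injective _ _ _ _ same =
      index-injective u∈ u∈′ i≡ , index-injective v∈ v∈′ x≡
  hyperedge-injective e (outS u∈) (inS v∈) e′ (outS u∈′) (inS v∈′) same
    with i≡ , x≡ ← spoke-injective _ _ _ _ same =
      index-injective u∈ u∈′ x≡ , index-injective v∈ v∈′ i≡
  hyperedge-injective e (inS u∈) (outS v∈) e′ (outS u∈′) (inS v∈′) same
    with i≡ , x≡ ← spoke-injective _ _ _ _ same =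
      ⊥-elim (edges-not-reversed e e′ (index-injective v∈ u∈′ x≡) (index-injective v∈′ u∈ (≡.sym i≡)))
  hyperedge-injective e (outS u∈) (inS v∈) e′ (inS u∈′) (outS v∈′) same
    with i≡ , x≡ ← spoke-injective _ _ _ _ same =
      ⊥-elim (edges-not-reversed e e′ (index-injective v∈ u∈′ i≡) (index-injective v∈′ u∈ (≡.sym x≡)))
  hyperedge-injective e (inS _) (inS _) e′ (inS _) (outS _) same =
    ⊥-elim (edge≢spoke _ _ _ _ _ same)
  hyperedge-injective e (inS _) (inS _) e′ (outS _) (inS _) same =
    ⊥-elim (edge≢spoke _ _ _ _ _ same)
  hyperedge-injective e su@(inS _) sv@(outS _) e′ su′@(inS _) sv′@(inS _) same =
    ⊥-elim (edge≢spoke _ _ _ _ _ (SameTriple-sym {s = hyperedge e su sv} {hyperedge e′ su′ sv′} same))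
  hyperedge-injective e su@(outS _) sv@(inS _) e′ su′@(inS _) sv′@(inS _) same =
    ⊥-elim (edge≢spoke _ _ _ _ _ (SameTriple-sym {s = hyperedge e su sv} {hyperedge e′ su′ sv′} same))

  splitBerge⇒berge : ContainsBerge G col cl
  splitBerge⇒berge =
    place ∘ side , (λ x y → place-injective (side x) (side y)) ,
    (λ e → hyperedge e (side (u e)) (side (v e))) ,
    (λ e e′ → hyperedge-injective e (side (u e)) (side (v e)) e′ (side (u e′)) (side (v e′))) ,
    (λ e → hyperedge-colour e (side (u e)) (side (v e))) , λ e → hyperedge-∋ e (side (u e)) (side (v e))

Near₂ : ∀ {M} → (Fin (suc M) → Fin (suc M) → Bool) → Bool → Fin M → Set
Near₂ {M} c cl x = c zero (suc x) ≡ cl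
  ⊎ c zero (suc x) ≢ cl × Σ (Fin M) λ y → y ≢ x × c zero (suc y) ≡ cl × c (suc y) (suc x) ≡ cl

Near₂? : ∀ {M} c cl (x : Fin M) → Dec (Near₂ c cl x)
Near₂? c cl x = c zero (suc x) Bool.≟ cl ⊎-dec ¬? (c zero (suc x) Bool.≟ cl) ×-dec
  Fin.any? λ y → ¬? (y Fin.≟ x) ×-dec c zero (suc y) Bool.≟ cl ×-dec c (suc y) (suc x) Bool.≟ cl

-- If zero is far from some x₀ in colour true, then x₀ is a stepping stone to everything in colour false.
radius≤2 : ∀ {M} (c : Fin (suc M) → Fin (suc M) → Bool) → (∀ y z → y ≢ z → c y z ≡ c z y) →
  Σ Bool λ cl → ∀ x → Near₂ c cl x
radius≤2 {M} c c-sym with Fin.all? (Near₂? c true)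
... | yes near = true , near
... | no ¬near with x₀ , x₀-far ← Fin.¬∀⟶∃¬ M (Near₂ c true) (Near₂? c true) ¬near = false , near
  where
  near : ∀ x → Near₂ c false x
  near x with c zero (suc x) in 0x
  ... | false = inj₁ refl
  ... | true = inj₂ ((λ ()) , x₀ , x₀≢x , Bool.¬-not 0x₀≢true , Bool.¬-not x₀x≢true)
    where
    x₀≢x : x₀ ≢ x
    x₀≢x refl = x₀-far (inj₁ 0x)
    0x₀≢true : c zero (suc x₀) ≢ true
    0x₀≢true = x₀-far ∘ inj₁
    x₀x≢true : c (suc x₀) (suc x) ≢ true
    x₀x≢true x₀x = x₀-far (inj₂ (0x₀≢true , x , x₀≢x ∘ ≡.sym , 0x ,
      trans (c-sym _ _ (x₀≢x ∘ ≡.sym ∘ Fin.suc-injective)) x₀x))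

Chain : ∀ {m} → (Fin m → Bool) → Bool → ℕ → Set
Chain {m} c cl a = Σ (Fin a → Fin m) λ e → e Preserves Fin._<_ ⟶ Fin._<_ × ∀ t → c (e t) ≡ cl

chain-singleton : ∀ {m} {c : Fin (suc m) → Bool} {cl} → c zero ≡ cl → Chain c cl 1
chain-singleton c₀ = (λ _ → zero) , (λ { {zero} {zero} () }) , λ { zero → c₀ }

chain-cons : ∀ {m} {c : Fin (suc m) → Bool} {cl a} → c zero ≡ cl → Chain (c ∘ suc) cl a →
  Chain c cl (suc a)
chain-cons {c = c} {cl} c₀ (e , e-mono , e-cl) = e′ , e′-mono , e′-cl
  where
  e′ : Fin _ → Fin _
  e′ zero = zero
  e′ (suc t) = suc (e t)
  e′-mono : e′ Preserves Fin._<_ ⟶ Fin._<_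
  e′-mono {zero} {suc t} _ = s≤s z≤n
  e′-mono {suc s} {suc t} s<t = s≤s (e-mono (s≤s⁻¹ s<t))
  e′-cl : ∀ t → c (e′ t) ≡ cl
  e′-cl zero = c₀
  e′-cl (suc t) = e-cl t

chain-tail : ∀ {m} {c : Fin (suc m) → Bool} {cl a} → Chain (c ∘ suc) cl a → Chain c cl a
chain-tail (e , e-mono , e-cl) = suc ∘ e , s≤s ∘ e-mono , e-cl

twoColourChains : ∀ {m} i j → i + j ≡ m → (c : Fin (suc m) → Bool) →
  Chain c true (suc i) ⊎ Chain c false (suc j)
twoColourChains i j eq c with c zero in c₀
twoColourChains zero j eq c | true = inj₁ (chain-singleton {c = c} c₀)
twoColourChains {zero} (suc i) j () c | true
twoColourChains {suc m} (suc i) j eq c | true =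
  Sum.map (chain-cons {c = c} c₀) (chain-tail {c = c}) (twoColourChains i j (ℕ.suc-injective eq) (c ∘ suc))
twoColourChains i zero eq c | false = inj₂ (chain-singleton {c = c} c₀)
twoColourChains {zero} i (suc j) eq c | false = contradiction (trans (≡.sym (ℕ.+-suc i j)) eq) λ ()
twoColourChains {suc m} i (suc j) eq c | false =
  Sum.map (chain-tail {c = c}) (chain-cons {c = c} c₀)
    (twoColourChains i j (ℕ.suc-injective (trans (≡.sym (ℕ.+-suc i j)) eq)) (c ∘ suc))

monochromaticChain : ∀ r (c : Fin (suc (r + r)) → Bool) → Σ Bool λ cl → Chain c cl (suc r)
monochromaticChain r c with twoColourChains r r refl c
... | inj₁ chain = true , chain
... | inj₂ chain = false , chain

module Fans {M N} (col : Colouring3 N) (high : Fin (suc M) → Fin N)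
            (high-mono : high Preserves Fin._<_ ⟶ Fin._<_) where

  high-injective : Injective _≡_ _≡_ high
  high-injective = strictlyMonotone⇒injective high-mono

  link : Fin N → Fin (suc M) → Fin (suc M) → Bool
  link p y z with y Fin.<? z
  ... | yes _ = col p (high y) (high z)
  ... | no _ = col p (high z) (high y)

  link-sym : ∀ p y z → y ≢ z → link p y z ≡ link p z y
  link-sym p y z y≢z with y Fin.<? z | z Fin.<? y
  ... | yes y<z | yes z<y = contradiction z<y (Fin.<-asym y<z)
  ... | yes _ | no _ = refl
  ... | no _ | yes _ = refl
  ... | no y≮z | no z≮y = contradiction (Fin.≤-antisym (ℕ.≮⇒≥ z≮y) (ℕ.≮⇒≥ y≮z)) y≢z

  fan : ∀ p → (∀ y → p Fin.< high y) → ∀ {y z} → OrderedPair y z → Triple N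
  fan p p<high s = triple p (high (lo s)) (high (hi s)) (p<high (lo s)) (high-mono (lo<hi s))

  fan-colour : ∀ p p<high {y z} (y≢z : y ≢ z) →
    colourOf col (fan p p<high (orderPair y≢z)) ≡ link p y z
  fan-colour p p<high {y} {z} y≢z with y Fin.<? z
  ... | yes _ = refl
  ... | no _ = refl

  module Split {k} (core : Fin k → Fin N) (core-mono : core Preserves Fin._<_ ⟶ Fin._<_)
               (core<high : ∀ i y → core i Fin.< high y) where

    outer : Fin M → Fin N
    outer = high ∘ suc

    core-injective : Injective _≡_ _≡_ core
    core-injective = strictlyMonotone⇒injective core-mono

    core≢high : ∀ i y → core i ≢ high y
    core≢high i y = Fin.<⇒≢ (core<high i y)

    -- Spokes leave core i through the hub (high zero) when the link colour allows it, and otherwise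
    -- through the middle of a two-step path of the right colour.
    module Rich (cl : Bool)
                (richPair : ∀ i j → i Fin.< j → Σ (Fin (suc M)) λ y → col (core i) (core j) (high y) ≡ cl)
                (near : ∀ i x → Near₂ (link (core i)) cl x) where

      via : ∀ {p x} → Near₂ (link p) cl x → Fin (suc M)
      via (inj₁ _) = zero
      via (inj₂ (_ , y , _)) = suc y

      via≢ : ∀ {p x} (r : Near₂ (link p) cl x) → via r ≢ suc x
      via≢ (inj₁ _) ()
      via≢ (inj₂ (_ , y , y≢x , _)) = y≢x ∘ Fin.suc-injective

      via-colour : ∀ {p x} (r : Near₂ (link p) cl x) → link p (via r) (suc x) ≡ cl
      via-colour (inj₁ direct) = direct
      via-colour (inj₂ (_ , _ , _ , _ , yx)) = yx

      via-not-crossed : ∀ {p x x′} (r : Near₂ (link p) cl x) (r′ : Near₂ (link p) cl x′) →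
        via r ≡ suc x′ → suc x ≢ via r′
      via-not-crossed (inj₁ _) _ ()
      via-not-crossed (inj₂ _) (inj₁ _) _ ()
      via-not-crossed (inj₂ (¬direct , _)) (inj₂ (_ , _ , _ , 0y′ , _)) _ refl = ¬direct 0y′

      spokePair : ∀ i x → OrderedPair (via (near i x)) (suc x)
      spokePair i x = orderPair (via≢ (near i x))

      splitBerge : SplitBerge k M col cl
      splitBerge = record
        { core = core
        ; outer = outer
        ; core-injective = core-injective
        ; outer-injective = Fin.suc-injective ∘ high-injective
        ; core≢outer = λ i x → core≢high i (suc x)
        ; edge = edge
        ; spoke = spoke
        ; edge-colour = λ i j i<j → proj₂ (richPair i j i<j)
        ; spoke-colour = λ i x →
            trans (fan-colour (core i) (core<high i) (via≢ (near i x))) (via-colour (near i x))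
        ; edge-∋ = λ _ _ _ → inj₁ refl , inj₂ (inj₁ refl)
        ; spoke-∋ = λ i x → inj₁ refl , inj₂ (Sum.map (cong high) (cong high) (lo-or-hi₂ (spokePair i x)))
        ; edge-injective = λ { _ _ _ _ _ _ (a≡ , b≡ , _) → core-injective a≡ , core-injective b≡ }
        ; spoke-injective = spoke-injective
        ; edge≢spoke = λ { _ j _ _ _ (_ , b≡ , _) → core≢high j _ b≡ }
        }
        where
        edge : ∀ i j → i Fin.< j → Triple N
        edge i j i<j =
          triple (core i) (core j) (high (proj₁ (richPair i j i<j))) (core-mono i<j) (core<high j _)
        spoke : Fin k → Fin M → Triple N
        spoke i x = fan (core i) (core<high i) (spokePair i x)
        spoke-injective : ∀ i x i′ x′ → SameTriple (spoke i x) (spoke i′ x′) → i ≡ i′ × x ≡ x′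
        spoke-injective i x i′ x′ (a≡ , b≡ , c≡) with core-injective a≡
        ... | refl with samePair (spokePair i x) (spokePair i x′) (high-injective b≡) (high-injective c≡)
        ...   | inj₁ (_ , sx≡sx′) = refl , Fin.suc-injective sx≡sx′
        ...   | inj₂ (crossed , crossed′) =
          contradiction crossed′ (via-not-crossed (near i x) (near i x′) crossed)

    -- Spokes from i use the pair {i, π i}; since π has no fixed points or 2-cycles, that pair determines i.
    module Poor (cl : Bool) (poorPair : ∀ i j → i Fin.< j → ∀ y → col (core i) (core j) (high y) ≡ cl)
                (π : Fin k → Fin k) (π-irrefl : ∀ i → π i ≢ i) (π²-irrefl : ∀ i → π (π i) ≢ i) where

      partner : ∀ i → OrderedPair i (π i)
      partner i = orderPair (π-irrefl i ∘ ≡.sym)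

      splitBerge : SplitBerge k M col cl
      splitBerge = record
        { core = core
        ; outer = outer
        ; core-injective = core-injective
        ; outer-injective = Fin.suc-injective ∘ high-injective
        ; core≢outer = λ i x → core≢high i (suc x)
        ; edge = λ i j i<j → triple (core i) (core j) (high zero) (core-mono i<j) (core<high j zero)
        ; spoke = spoke
        ; edge-colour = λ i j i<j → poorPair i j i<j zero
        ; spoke-colour = λ i x → poorPair (lo (partner i)) (hi (partner i)) (lo<hi (partner i)) (suc x)
        ; edge-∋ = λ _ _ _ → inj₁ refl , inj₂ (inj₁ refl)
        ; spoke-∋ = λ i x →
            Sum.map (cong core) (inj₁ ∘ cong core) (lo-or-hi₁ (partner i)) , inj₂ (inj₂ refl)
        ; edge-injective = λ { _ _ _ _ _ _ (a≡ , b≡ , _) → core-injective a≡ , core-injective b≡ }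
        ; spoke-injective = spoke-injective
        ; edge≢spoke = λ { _ _ _ _ _ (_ , _ , c≡) → contradiction (high-injective c≡) λ () }
        }
        where
        spoke : Fin k → Fin M → Triple N
        spoke i x = let s = partner i in
          triple (core (lo s)) (core (hi s)) (outer x) (core-mono (lo<hi s)) (core<high (hi s) (suc x))
        spoke-injective : ∀ i x i′ x′ → SameTriple (spoke i x) (spoke i′ x′) → i ≡ i′ × x ≡ x′
        spoke-injective i x i′ x′ (a≡ , b≡ , c≡)
          with samePair (partner i) (partner i′) (core-injective a≡) (core-injective b≡)
        ... | inj₁ (i≡i′ , _) = i≡i′ , Fin.suc-injective (high-injective c≡)
        ... | inj₂ (i≡πi′ , πi≡i′) = contradiction (trans (cong π (≡.sym i≡πi′)) πi≡i′) (π²-irrefl i′)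

rotation : ∀ {k} → Fin (3 + k) → Fin (3 + k)
rotation zero = suc zero
rotation (suc zero) = suc (suc zero)
rotation (suc (suc _)) = zero

rotation-irrefl : ∀ {k} (i : Fin (3 + k)) → rotation i ≢ i
rotation-irrefl zero ()
rotation-irrefl (suc zero) ()
rotation-irrefl (suc (suc _)) ()

rotation²-irrefl : ∀ {k} (i : Fin (3 + k)) → rotation (rotation i) ≢ i
rotation²-irrefl zero ()
rotation²-irrefl (suc zero) ()
rotation²-irrefl (suc (suc _)) ()

module UpperBound {k M r : ℕ} (ramsey : KArrow (3 + k) (suc r)) where

  N : ℕ
  N = suc (r + r) + suc M

  low : Fin (suc (r + r)) → Fin N
  low i = i ↑ˡ suc M

  high : Fin (suc M) → Fin N
  high y = suc (r + r) ↑ʳ y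

  low-mono : low Preserves Fin._<_ ⟶ Fin._<_
  low-mono {i} {j} i<j rewrite Fin.toℕ-↑ˡ i (suc M) | Fin.toℕ-↑ˡ j (suc M) = i<j

  high-mono : high Preserves Fin._<_ ⟶ Fin._<_
  high-mono {y} {z} y<z rewrite Fin.toℕ-↑ʳ (suc (r + r)) y | Fin.toℕ-↑ʳ (suc (r + r)) z =
    ℕ.+-monoʳ-< (suc (r + r)) y<z

  low<high : ∀ i y → low i Fin.< high y
  low<high i y rewrite Fin.toℕ-↑ˡ i (suc M) | Fin.toℕ-↑ʳ (suc (r + r)) y =
    ℕ.<-≤-trans (Fin.toℕ<n i) (ℕ.m≤m+n (suc (r + r)) (toℕ y))

  module _ (col : Colouring3 N) where
    open Fans col high high-mono

    hubColour : Fin N → Bool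
    hubColour p = proj₁ (radius≤2 (link p) (link-sym p))

    RichPair : Bool → Fin N → Fin N → Set
    RichPair cl p q = Σ (Fin (suc M)) λ y → col p q (high y) ≡ cl

    richPair? : ∀ cl p q → Dec (RichPair cl p q)
    richPair? cl p q = Fin.any? λ y → col p q (high y) Bool.≟ cl

    splitBerge : Σ Bool λ cl → SplitBerge (3 + k) M col cl
    splitBerge with monochromaticChain r (hubColour ∘ low)
    ... | cl , e , e-mono , e-cl
      with ramsey (λ s t → does (richPair? cl (low (e s)) (low (e t))))
    ... | true , φ , φ-mono , rich = cl , S.Rich.splitBerge cl richPair near
      where
      core : Fin (3 + k) → Fin N
      core = low ∘ e ∘ φ
      module S = Split core (λ i<j → low-mono (e-mono (φ-mono _ _ i<j))) (low<high ∘ e ∘ φ)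
      richPair : ∀ i j → i Fin.< j → RichPair cl (core i) (core j)
      richPair i j i<j = does≡true⇒ (richPair? cl (core i) (core j)) (rich i j i<j)
      near : ∀ i x → Near₂ (link (core i)) cl x
      near i = subst (λ c → ∀ x → Near₂ (link (core i)) c x) (e-cl (φ i)) (proj₂ (radius≤2 _ _))
    ... | false , φ , φ-mono , poor =
      not cl , S.Poor.splitBerge (not cl) poorPair rotation rotation-irrefl rotation²-irrefl
      where
      core : Fin (3 + k) → Fin N
      core = low ∘ e ∘ φ
      module S = Split core (λ i<j → low-mono (e-mono (φ-mono _ _ i<j))) (low<high ∘ e ∘ φ)
      poorPair : ∀ i j → i Fin.< j → ∀ y → col (core i) (core j) (high y) ≡ not cl
      poorPair i j i<j y =
        Bool.¬-not λ eq → does≡false⇒¬ (richPair? cl (core i) (core j)) (poor i j i<j) (y , eq)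

1+r+r+[1+m]≡m+2*[1+r] : ∀ r m → suc (r + r) + suc m ≡ m + 2 * suc r
1+r+r+[1+m]≡m+2*[1+r] =
  solve 2 (λ r m → (con 1 :+ (r :+ r)) :+ (con 1 :+ m) := m :+ con 2 :* (con 1 :+ r)) refl
  where open +-*-Solver

upperBound : ∀ {n} {G : Graph n} {k r} → VertexCoverNumber G (3 + k) → KArrow (3 + k) (suc r) →
  BergeArrow G (n ∸ (3 + k) + 2 * suc r)
upperBound {n} {G} {k} {r} ((S , cover , ∣S∣≡k) , _) ramsey =
  subst (BergeArrow G) (1+r+r+[1+m]≡m+2*[1+r] r (n ∸ (3 + k))) λ col →
    map₂ (splitBerge⇒berge cover ∘ subst₂ (λ a b → SplitBerge a b col _) (≡.sym ∣S∣≡k) (≡.sym ∣∁S∣≡n∸k))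
         (UpperBound.splitBerge ramsey col)
  where
  ∣∁S∣≡n∸k : ∣ ∁ S ∣ ≡ n ∸ (3 + k)
  ∣∁S∣≡n∸k = trans (∣∁p∣≡n∸∣p∣ S) (cong (n ∸_) ∣S∣≡k)

KArrow-nonempty : ∀ {k} → ¬ KArrow (suc k) 0
KArrow-nonempty arrow with () ← proj₁ (proj₂ (arrow λ _ _ → true)) zero

proposition7 : ∀ (n : ℕ) (G : Graph n) (k : ℕ) → VertexCoverNumber G k → 3 ≤ k →
    ∀ (rK : ℕ) → GraphRamseyK k rK →
    Σ ℕ λ R → BergeRamsey G R × ((2 * k ∸ 1 ≤ R) × (R ≤ n ∸ k + 2 * rK))
proposition7 n G (suc (suc (suc k))) vc (s≤s (s≤s (s≤s _))) zero (ramsey , _) =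
  contradiction ramsey KArrow-nonempty
proposition7 n G (suc (suc (suc k))) vc (s≤s (s≤s (s≤s _))) (suc r) (ramsey , _) =
  least-between (BergeDecidable.BergeArrow? G) (λ _ → lowerBound vc) (upperBound vc ramsey)
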